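{- For any integer $c\ge 2$, $\chi(c-1,c)\ge 2c-1$.
   Context: A hypergraph $G$ consists of a finite vertex set together with a collection of subsets of it (edges). For an integer $c\ge 2$, a $c$-strong coloring of $G$ is an assignment of colors to its vertices such that every edge $e$ of $G$ contains vertices of at least $\min\{c,|e|\}$ distinct colors. $G$ is $t$-intersecting if every two edges of $G$ have at least $t$ vertices in common. For integers $c\ge 2$, $t\ge 0$, $\chi(t,c)$ denotes the minimum number of colors that suffices to $c$-strong color every $t$-intersecting hypergraph ($\infty$ if no finite number suffices). -}

module Defs where

open import Data.Nat using (ℕ; _≤_; _⊓_; _∸_; _+_; _*_)
open import Data.Fin using (Fin; _≟_)
open import Data.Fin.Subset using (Subset; _∩_; ∣_∣)
open import Data.Vec using (lookup; tabulate)
open import Data.Bool using (Bool; _∧_)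
open import Data.Bool.ListAction using (any)
open import Data.List using (List; allFin)
open import Data.List.Membership.Propositional using (_∈_)
open import Data.Product using (Σ)
open import Relation.Nullary.Decidable using (⌊_⌋)

record Hypergraph : Set where
  field
    n     : ℕ
    edges : List (Subset n)
open Hypergraph public

Intersecting : ℕ → Hypergraph → Set
Intersecting t G = ∀ {e e'} → e ∈ edges G → e' ∈ edges G → t ≤ ∣ e ∩ e' ∣

colorsOn : ∀ {n k} → (Fin n → Fin k) → Subset n → Subset k
colorsOn {n} f e = tabulate (λ j → any (λ v → lookup e v ∧ ⌊ f v ≟ j ⌋) (allFin n))

IsStrongColoring : ℕ → (G : Hypergraph) → ∀ {k} → (Fin (n G) → Fin k) → Set
IsStrongColoring c G f = ∀ {e} → e ∈ edges G → c ⊓ ∣ e ∣ ≤ ∣ colorsOn f e ∣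

Suffices : ℕ → ℕ → ℕ → Set
Suffices t c k = (G : Hypergraph) → Intersecting t G →
  Σ (Fin (n G) → Fin k) (IsStrongColoring c G)

-- χ(t,c) ≥ m  (χ = min{k | Suffices t c k}, ∞ if no such k):
-- every k that suffices is at least m.
χ≥ : ℕ → ℕ → ℕ → Set
χ≥ t c m = ∀ k → Suffices t c k → m ≤ k

module Submission where

-- Put m = c − 1 and take as edges all subsets of size ≥ 2m of a 3m-element set; any two of
-- them meet in at least 4m − 3m = m vertices. For a colouring with k ≤ 2m colours, choose
-- greedily at most m colour classes covering at least 2m vertices: classes of size ≥ 2 pay
-- for themselves, and classes of size ≤ 1 can be skipped while more than m colours remain,
-- losing at most k − m ≤ m vertices. The union of the chosen classes is an edge with at
-- least c vertices but at most m < c colours.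

open import Data.Bool using (Bool; if_then_else_; _∧_)
open import Data.Bool.ListAction using (any)
open import Data.Bool.Properties using (T-≡; T-∧)
open import Data.Fin using (Fin; zero; suc; _≟_)
open import Data.Fin.Subset using (Subset; inside; outside; _∩_; _∪_; _⊆_; ∣_∣; ⊤; ⊥)
open import Data.Fin.Subset.Properties using (∣p∣≤n; ∣⊤∣≡n; ∣⊥∣≡0; p⊆q⇒∣p∣≤∣q∣)
open import Data.List using (List; [_]; allFin; filter; map; _++_)
open import Data.List.Membership.Propositional using (_∈_)
open import Data.List.Membership.Propositional.Properties using (∈-filter⁺; ∈-filter⁻; ∈-++⁺ˡ; ∈-++⁺ʳ; ∈-map⁺)
open import Data.List.Relation.Unary.Any using (here; satisfied)
open import Data.List.Relation.Unary.Any.Properties using (any⁻)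
open import Data.Nat using (ℕ; zero; suc; _+_; _∸_; _*_; _⊓_; _≤_; _<_; z≤n; s≤s; _≤?_)
open import Data.Nat.Properties
  using ( +-suc; +-assoc; +-comm; +-identityʳ; +-mono-≤; +-monoˡ-≤; +-monoʳ-≤; +-cancelˡ-≤
        ; +-distribˡ-⊓; ⊓-mono-≤; ⊓-monoʳ-≤; ⊓-glb; m⊓n≤n; ∸-monoˡ-≤; ∸-monoʳ-≤; m∸n≤m
        ; m+n∸n≡m; +-∸-assoc; m≤n+m∸n; m≤n+o⇒m∸n≤o; ≤-refl; ≤-reflexive; ≤-trans; ≤-pred
        ; ≰⇒>; 1+n≰n; module ≤-Reasoning; +-commutativeSemigroup)
open import Algebra.Properties.CommutativeSemigroup +-commutativeSemigroup using (interchange; x∙yz≈y∙xz)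
open import Data.Product using (∃-syntax; _×_; _,_; proj₂)
open import Data.Vec using ([]; _∷_; lookup; tabulate)
open import Data.Vec.Properties
  using (lookup∘tabulate; tabulate∘lookup; tabulate-cong; lookup-replicate; []=⇒lookup; lookup⇒[]=)
open import Function using (_∘_; _$_; Equivalence)
open import Relation.Binary.PropositionalEquality
  using (_≡_; _≗_; refl; sym; trans; cong; cong₂; subst; module ≡-Reasoning)
open import Relation.Nullary using (Dec; yes; no; contradiction)
open import Relation.Nullary.Decidable using (⌊_⌋; toWitness)

open import Defs

indicator : Bool → ℕ
indicator b = if b then 1 else 0

∣∷∣ : ∀ {n} b (p : Subset n) → ∣ b ∷ p ∣ ≡ indicator b + ∣ p ∣
∣∷∣ inside  p = refl
∣∷∣ outside p = refl

∣p∣+∣q∣≡∣p∪q∣+∣p∩q∣ : ∀ {n} (p q : Subset n) → ∣ p ∣ + ∣ q ∣ ≡ ∣ p ∪ q ∣ + ∣ p ∩ q ∣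
∣p∣+∣q∣≡∣p∪q∣+∣p∩q∣ []            []            = refl
∣p∣+∣q∣≡∣p∪q∣+∣p∩q∣ (inside  ∷ p) (inside  ∷ q) = cong suc $ begin
  ∣ p ∣ + suc ∣ q ∣           ≡⟨ +-suc ∣ p ∣ ∣ q ∣ ⟩
  suc (∣ p ∣ + ∣ q ∣)         ≡⟨ cong suc (∣p∣+∣q∣≡∣p∪q∣+∣p∩q∣ p q) ⟩
  suc (∣ p ∪ q ∣ + ∣ p ∩ q ∣) ≡⟨ +-suc ∣ p ∪ q ∣ ∣ p ∩ q ∣ ⟨
  ∣ p ∪ q ∣ + suc ∣ p ∩ q ∣   ∎
  where open ≡-Reasoning
∣p∣+∣q∣≡∣p∪q∣+∣p∩q∣ (inside  ∷ p) (outside ∷ q) = cong suc (∣p∣+∣q∣≡∣p∪q∣+∣p∩q∣ p q)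
∣p∣+∣q∣≡∣p∪q∣+∣p∩q∣ (outside ∷ p) (inside  ∷ q) =
  trans (+-suc ∣ p ∣ ∣ q ∣) (cong suc (∣p∣+∣q∣≡∣p∪q∣+∣p∩q∣ p q))
∣p∣+∣q∣≡∣p∪q∣+∣p∩q∣ (outside ∷ p) (outside ∷ q) = ∣p∣+∣q∣≡∣p∪q∣+∣p∩q∣ p q

∣p∣+∣q∣≤n+∣p∩q∣ : ∀ {n} (p q : Subset n) → ∣ p ∣ + ∣ q ∣ ≤ n + ∣ p ∩ q ∣
∣p∣+∣q∣≤n+∣p∩q∣ p q = begin
  ∣ p ∣ + ∣ q ∣         ≡⟨ ∣p∣+∣q∣≡∣p∪q∣+∣p∩q∣ p q ⟩
  ∣ p ∪ q ∣ + ∣ p ∩ q ∣ ≤⟨ +-monoˡ-≤ ∣ p ∩ q ∣ (∣p∣≤n (p ∪ q)) ⟩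
  _ + ∣ p ∩ q ∣         ∎
  where open ≤-Reasoning

allSubsets : ∀ n → List (Subset n)
allSubsets 0       = [ [] ]
allSubsets (suc n) = map (inside ∷_) (allSubsets n) ++ map (outside ∷_) (allSubsets n)

∈-allSubsets : ∀ {n} (p : Subset n) → p ∈ allSubsets n
∈-allSubsets []            = here refl
∈-allSubsets (inside  ∷ p) = ∈-++⁺ˡ (∈-map⁺ (inside ∷_) (∈-allSubsets p))
∈-allSubsets (outside ∷ p) = ∈-++⁺ʳ (map (inside ∷_) (allSubsets _)) (∈-map⁺ (outside ∷_) (∈-allSubsets p))

sumOver : ∀ {k} → Subset k → (Fin k → ℕ) → ℕ
sumOver []            w = 0
sumOver (inside  ∷ C) w = w zero + sumOver C (w ∘ suc)
sumOver (outside ∷ C) w = sumOver C (w ∘ suc)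

sumOver-cong : ∀ {k} (C : Subset k) {v w : Fin k → ℕ} → v ≗ w → sumOver C v ≡ sumOver C w
sumOver-cong []            v≗w = refl
sumOver-cong (inside  ∷ C) v≗w = cong₂ _+_ (v≗w zero) (sumOver-cong C (v≗w ∘ suc))
sumOver-cong (outside ∷ C) v≗w = sumOver-cong C (v≗w ∘ suc)

sumOver-zero : ∀ {k} (C : Subset k) → sumOver C (λ _ → 0) ≡ 0
sumOver-zero []            = refl
sumOver-zero (inside  ∷ C) = sumOver-zero C
sumOver-zero (outside ∷ C) = sumOver-zero C

sumOver-+ : ∀ {k} (C : Subset k) (v w : Fin k → ℕ) →
  sumOver C (λ j → v j + w j) ≡ sumOver C v + sumOver C w
sumOver-+ []            v w = refl
sumOver-+ (inside  ∷ C) v w = trans (cong (v zero + w zero +_) (sumOver-+ C (v ∘ suc) (w ∘ suc)))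
  (interchange (v zero) (w zero) (sumOver C (v ∘ suc)) (sumOver C (w ∘ suc)))
sumOver-+ (outside ∷ C) v w = sumOver-+ C (v ∘ suc) (w ∘ suc)

indicator-suc≟suc : ∀ {k} (i j : Fin k) → indicator ⌊ suc i ≟ suc j ⌋ ≡ indicator ⌊ i ≟ j ⌋
indicator-suc≟suc i j with i ≟ j
... | yes _ = refl
... | no  _ = refl

sumOver-indicator : ∀ {k} (C : Subset k) (i : Fin k) →
  sumOver C (λ j → indicator ⌊ i ≟ j ⌋) ≡ indicator (lookup C i)
sumOver-indicator (inside  ∷ C) zero    = cong suc (sumOver-zero C)
sumOver-indicator (outside ∷ C) zero    = sumOver-zero C
sumOver-indicator (inside  ∷ C) (suc i) =
  trans (sumOver-cong C (indicator-suc≟suc i)) (sumOver-indicator C i)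
sumOver-indicator (outside ∷ C) (suc i) =
  trans (sumOver-cong C (indicator-suc≟suc i)) (sumOver-indicator C i)

classSize : ∀ {n k} → (Fin n → Fin k) → Fin k → ℕ
classSize f j = ∣ tabulate (λ v → ⌊ f v ≟ j ⌋) ∣

preimage : ∀ {n k} → (Fin n → Fin k) → Subset k → Subset n
preimage f C = tabulate (lookup C ∘ f)

sumOver-classSize : ∀ {n k} (f : Fin n → Fin k) (C : Subset k) →
  sumOver C (classSize f) ≡ ∣ preimage f C ∣
sumOver-classSize {zero}  f C = sumOver-zero C
sumOver-classSize {suc n} f C = begin
  sumOver C (classSize f)
    ≡⟨ sumOver-cong C (λ j → ∣∷∣ ⌊ f zero ≟ j ⌋ (tabulate (λ v → ⌊ f (suc v) ≟ j ⌋))) ⟩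
  sumOver C (λ j → indicator ⌊ f zero ≟ j ⌋ + classSize (f ∘ suc) j)
    ≡⟨ sumOver-+ C _ _ ⟩
  sumOver C (λ j → indicator ⌊ f zero ≟ j ⌋) + sumOver C (classSize (f ∘ suc))
    ≡⟨ cong₂ _+_ (sumOver-indicator C (f zero)) (sumOver-classSize (f ∘ suc) C) ⟩
  indicator (lookup C (f zero)) + ∣ preimage (f ∘ suc) C ∣
    ≡⟨ ∣∷∣ (lookup C (f zero)) (preimage (f ∘ suc) C) ⟨
  ∣ preimage f C ∣
    ∎
  where open ≡-Reasoning

preimage-⊤ : ∀ {n k} (f : Fin n → Fin k) → preimage f ⊤ ≡ ⊤
preimage-⊤ f = trans (tabulate-cong λ v → trans (lookup-replicate (f v) inside) (sym (lookup-replicate v inside)))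
                     (tabulate∘lookup ⊤)

sumOver-⊤-classSize : ∀ {n k} (f : Fin n → Fin k) → sumOver ⊤ (classSize f) ≡ n
sumOver-⊤-classSize {n} f = trans (sumOver-classSize f ⊤) (trans (cong ∣_∣ (preimage-⊤ f)) (∣⊤∣≡n n))

lookup-colorsOn⁻ : ∀ {n k} (f : Fin n → Fin k) (e : Subset n) {j : Fin k} →
  lookup (colorsOn f e) j ≡ inside → ∃[ v ] lookup e v ≡ inside × f v ≡ j
lookup-colorsOn⁻ {n} f e {j} j∈colors
  with satisfied (any⁻ _ (allFin n) (Equivalence.from T-≡ (trans (sym (lookup∘tabulate _ j)) j∈colors)))
... | v , v-witnesses-j with Equivalence.to T-∧ v-witnesses-j
...   | v∈e , fv≡j = v , Equivalence.to T-≡ v∈e , toWitness fv≡j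

colorsOn-preimage-⊆ : ∀ {n k} (f : Fin n → Fin k) (C : Subset k) → colorsOn f (preimage f C) ⊆ C
colorsOn-preimage-⊆ f C {j} j∈colors with lookup-colorsOn⁻ f (preimage f C) ([]=⇒lookup j∈colors)
... | v , v∈preimage , refl = lookup⇒[]= (f v) C (trans (sym (lookup∘tabulate (lookup C ∘ f) v)) v∈preimage)

m+n∸o≤m+[n∸o] : ∀ m n o → m + n ∸ o ≤ m + (n ∸ o)
m+n∸o≤m+[n∸o] m n o = m≤n+o⇒m∸n≤o (m + n) o $ begin
  m + n             ≤⟨ +-monoʳ-≤ m (m≤n+m∸n n o) ⟩
  m + (o + (n ∸ o)) ≡⟨ x∙yz≈y∙xz m o (n ∸ o) ⟩
  o + (m + (n ∸ o)) ∎
  where open ≤-Reasoning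

take-heavy : ∀ {a} m T y {S} → 2 ≤ a → (m + m) ⊓ (T ∸ y) ≤ S →
  (suc m + suc m) ⊓ (a + T ∸ y) ≤ a + S
take-heavy {a} m T y {S} 2≤a bound = begin
  (suc m + suc m) ⊓ (a + T ∸ y)   ≤⟨ ⊓-mono-≤ two-more-colours (m+n∸o≤m+[n∸o] a T y) ⟩
  (a + (m + m)) ⊓ (a + (T ∸ y))   ≡⟨ +-distribˡ-⊓ a (m + m) (T ∸ y) ⟨
  a + (m + m) ⊓ (T ∸ y)           ≤⟨ +-monoʳ-≤ a bound ⟩
  a + S                           ∎
  where
  open ≤-Reasoning
  two-more-colours : suc m + suc m ≤ a + (m + m)
  two-more-colours = subst (_≤ a + (m + m)) (cong suc (sym (+-suc m m))) (+-monoˡ-≤ (m + m) 2≤a)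

skip-light : ∀ {a} T {k m} → a ≤ 1 → m < k → a + T ∸ (k ∸ m) ≤ T ∸ (k ∸ suc m)
skip-light {a} T {k} {m} a≤1 m<k = begin
  a + T ∸ (k ∸ m)         ≡⟨ cong (a + T ∸_) (+-∸-assoc 1 m<k) ⟩
  a + T ∸ suc (k ∸ suc m) ≤⟨ ∸-monoˡ-≤ (suc (k ∸ suc m)) (+-monoˡ-≤ T a≤1) ⟩
  T ∸ (k ∸ suc m)         ∎
  where open ≤-Reasoning

-- The subtracted k ∸ m pays for skipping colours of weight ≤ 1, each costing at most 1.
heavyColours : ∀ {k} (w : Fin k → ℕ) m →
  ∃[ C ] ∣ C ∣ ≤ m × (m + m) ⊓ (sumOver ⊤ w ∸ (k ∸ m)) ≤ sumOver C w
heavyColours {zero}  w m       = [] , z≤n , ≤-trans (m⊓n≤n _ _) (m∸n≤m 0 (0 ∸ m))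
heavyColours {suc k} w zero    = ⊥ , ≤-reflexive (∣⊥∣≡0 (suc k)) , z≤n
heavyColours {suc k} w (suc m) with k ≤? m
... | yes k≤m = ⊤ , subst (_≤ suc m) (sym (∣⊤∣≡n (suc k))) (s≤s k≤m) ,
                  ≤-trans (m⊓n≤n _ _) (m∸n≤m (sumOver ⊤ w) (k ∸ m))
... | no  k≰m with 2 ≤? w zero
...   | yes 2≤w₀ with heavyColours (w ∘ suc) m
...     | C , ∣C∣≤m , bound =
  inside ∷ C , s≤s ∣C∣≤m , take-heavy m (sumOver ⊤ (w ∘ suc)) (k ∸ m) 2≤w₀ bound
heavyColours {suc k} w (suc m) | no k≰m | no 2≰w₀ with heavyColours (w ∘ suc) (suc m)
... | C , ∣C∣≤m , bound =
  outside ∷ C , ∣C∣≤m , ≤-trans (⊓-monoʳ-≤ (suc m + suc m) (skip-light _ (≤-pred (≰⇒> 2≰w₀)) (≰⇒> k≰m))) bound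

large? : ∀ m {n} (e : Subset n) → Dec (m + m ≤ ∣ e ∣)
large? m e = m + m ≤? ∣ e ∣

largeSubsets : ℕ → Hypergraph
largeSubsets m = record { n = m + m + m ; edges = filter (large? m) (allSubsets (m + m + m)) }

large-edge : ∀ m {e} → e ∈ edges (largeSubsets m) → m + m ≤ ∣ e ∣
large-edge m = proj₂ ∘ ∈-filter⁻ (large? m) {xs = allSubsets (m + m + m)}

largeSubsets-intersecting : ∀ m → Intersecting m (largeSubsets m)
largeSubsets-intersecting m {e} {e'} e∈ e'∈ = +-cancelˡ-≤ (m + m + m) m ∣ e ∩ e' ∣ $ begin
  m + m + m + m             ≡⟨ +-assoc (m + m) m m ⟩
  (m + m) + (m + m)         ≤⟨ +-mono-≤ (large-edge m e∈) (large-edge m e'∈) ⟩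
  ∣ e ∣ + ∣ e' ∣            ≤⟨ ∣p∣+∣q∣≤n+∣p∩q∣ e e' ⟩
  m + m + m + ∣ e ∩ e' ∣    ∎
  where open ≤-Reasoning

m+m≤m+m+m∸[k∸m] : ∀ m {k} → k ≤ m + m → m + m ≤ m + m + m ∸ (k ∸ m)
m+m≤m+m+m∸[k∸m] m {k} k≤2m = begin
  m + m               ≡⟨ m+n∸n≡m (m + m) m ⟨
  m + m + m ∸ m       ≤⟨ ∸-monoʳ-≤ (m + m + m) (m≤n+o⇒m∸n≤o k m k≤2m) ⟩
  m + m + m ∸ (k ∸ m) ∎
  where open ≤-Reasoning

heavy-preimage : ∀ m {k} → k ≤ m + m → (f : Fin (m + m + m) → Fin k) →
  ∃[ C ] ∣ C ∣ ≤ m × m + m ≤ ∣ preimage f C ∣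
heavy-preimage m {k} k≤2m f with heavyColours (classSize f) m
... | C , ∣C∣≤m , bound = C , ∣C∣≤m , (begin
  m + m                                         ≤⟨ ⊓-glb ≤-refl (m+m≤m+m+m∸[k∸m] m k≤2m) ⟩
  (m + m) ⊓ (m + m + m ∸ (k ∸ m))               ≡⟨ cong (λ T → (m + m) ⊓ (T ∸ (k ∸ m))) (sumOver-⊤-classSize f) ⟨
  (m + m) ⊓ (sumOver ⊤ (classSize f) ∸ (k ∸ m)) ≤⟨ bound ⟩
  sumOver C (classSize f)                       ≡⟨ sumOver-classSize f C ⟩
  ∣ preimage f C ∣                              ∎)
  where open ≤-Reasoning

few-coloured-large-edge : ∀ m {k} → k ≤ m + m → (f : Fin (m + m + m) → Fin k) →
  ∃[ e ] e ∈ edges (largeSubsets m) × ∣ colorsOn f e ∣ ≤ m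
few-coloured-large-edge m k≤2m f with heavy-preimage m k≤2m f
... | C , ∣C∣≤m , large = preimage f C , ∈-filter⁺ (large? m) (∈-allSubsets (preimage f C)) large
                        , ≤-trans (p⊆q⇒∣p∣≤∣q∣ (colorsOn-preimage-⊆ f C)) ∣C∣≤m

suffices⇒2m<k : ∀ m {k} → 1 ≤ m → Suffices m (suc m) k → m + m < k
suffices⇒2m<k m {k} 1≤m suffices with k ≤? m + m
... | no  k≰2m = ≰⇒> k≰2m
... | yes k≤2m with suffices (largeSubsets m) (largeSubsets-intersecting m)
...   | f , strong with few-coloured-large-edge m k≤2m f
...     | e , e∈ , few = contradiction (begin
  suc m             ≤⟨ ⊓-glb ≤-refl (≤-trans suc-m≤m+m (large-edge m e∈)) ⟩
  suc m ⊓ ∣ e ∣     ≤⟨ strong e∈ ⟩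
  ∣ colorsOn f e ∣  ≤⟨ few ⟩
  m                 ∎) 1+n≰n
  where
  open ≤-Reasoning
  suc-m≤m+m : suc m ≤ m + m
  suc-m≤m+m = subst (_≤ m + m) (+-comm m 1) (+-monoʳ-≤ m 1≤m)

mainTheorem4 : (c : ℕ) → 2 ≤ c → χ≥ (c ∸ 1) c (2 * c ∸ 1)
mainTheorem4 (suc m) (s≤s 1≤m) k suffices =
  subst (_≤ k) (sym 2c∸1≡1+2m) (suffices⇒2m<k m 1≤m suffices)
  where
  2c∸1≡1+2m : 2 * suc m ∸ 1 ≡ suc (m + m)
  2c∸1≡1+2m = trans (cong (m +_) (+-identityʳ (suc m))) (+-suc m m)
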